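{- The inverse insertion procedure is the inverse of the insertion procedure.
   Context: Let $\star$ denote a letter representing a box of the basement. A weighted Dyck word is a word $w$ with letters in $\{\star,U,D\}\cup\mathbb{N}$ such that: (i) $w$ belongs to the language $\left(\star(U+D)\mathbb{N}(U+D)\right)^*\star$; (ii) the subword of $w$ in the letters $D$ and $U$ is a Dyck word (every prefix has at least as many $D$'s as $U$'s, with equality for the whole word); (iii) for each position $i$ with $w(i)\in\mathbb{N}$, $w(i)<ch(i,w)$, where $ch(i,w):=\left\lceil \frac{|\{ j<i \mid w(j)=D \}| - |\{ j<i \mid w(j)=U \}|}{2}\right\rceil$ is the column height. The integer letters are the weights; the size is the number of weights. A weight $w(i)$ is maximal if $w(i)=ch(i,w)-1$; it is eligible if it is maximal and immediately preceded by $D$; the special weight is the right-most eligible weight. A column addition replaces a letter $\star$ at position $i$ by $\star\, D\, m\, U\, \star$ with $m=ch(i,w)-1$ (the new weight). A ribbon addition on a letter $U$ placed before a letter $D$ exchanges these two letters. The insertion procedure, applied to a weighted Dyck word of size $k\ge0$ and a chosen letter $\star$, is: (1) find the special weight $s$ (skipped if $k=0$); (2) choose a letter $\star$; (3) perform a column addition at the chosen $\star$; (4) if the chosen $\star$ is to the left of $s$, perform a ribbon addition on the $U$ letter following the new weight and the $D$ letter preceding $s$. The inverse insertion procedure, applied to a weighted Dyck word of size $k\ge1$, is: (1) find the special weight $s$; (2) if the letter following $s$ is $D$, find the leftmost maximal weight $m$ placed to the right of $s$ (the letter preceding $m$ is then $U$) and exchange this $D$ and this $U$; (3) replace the factor $\star\,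 D\, s\, U\, \star$ by a single letter $\star$. It outputs a weighted Dyck word of size $k-1$ together with the position (among the letters $\star$) where $s$ was. -}

module Defs where

open import Data.Nat.Base using (ℕ; zero; suc; _+_; _∸_; _≤_; _<_; ⌈_/2⌉; _≡ᵇ_; _<ᵇ_)
open import Data.Bool.Base using (Bool; true; false; if_then_else_; _∧_)
open import Data.List.Base using (List; []; _∷_; _++_; take; drop; length)
open import Data.Maybe.Base using (Maybe; just; nothing)
open import Data.Product.Base using (_×_; _,_)
open import Relation.Binary.PropositionalEquality using (_≡_)

data Letter : Set where
  ⋆ U D : Letter
  wt    : ℕ → Letter

Word : Set
Word = List Letter

at : Word → ℕ → Maybe Letter
at []      _       = nothing
at (a ∷ w) zero    = just a
at (a ∷ w) (suc i) = at w i

setAt : Word → ℕ → Letter → Word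
setAt []      _       b = []
setAt (a ∷ w) zero    b = b ∷ w
setAt (a ∷ w) (suc i) b = a ∷ setAt w i b

swap : Word → ℕ → ℕ → Word
swap w i j with at w i | at w j
... | just a | just b = setAt (setAt w i b) j a
... | _      | _      = w

isD isU isStar : Letter → Bool
isD D = true
isD _ = false
isU U = true
isU _ = false
isStar ⋆ = true
isStar _ = false

countD countU countStar size : Word → ℕ
countD []      = 0
countD (a ∷ w) = (if isD a then 1 else 0) + countD w
countU []      = 0
countU (a ∷ w) = (if isU a then 1 else 0) + countU w
countStar []      = 0
countStar (a ∷ w) = (if isStar a then 1 else 0) + countStar w
size []          = 0
size (wt _ ∷ w)  = suc (size w)
size (_ ∷ w)     = size w

-- Column height: ch(i,w) = ⌈ (#D before i − #U before i) / 2 ⌉,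
-- computed from the prefix of w strictly before position i.
-- (In a Dyck word #D ≥ #U on prefixes, so truncated subtraction is exact.)

chPre : Word → ℕ
chPre p = ⌈ (countD p ∸ countU p) /2⌉

ch : ℕ → Word → ℕ
ch i w = chPre (take i w)

data IsUD : Letter → Set where
  isU' : IsUD U
  isD' : IsUD D

data InLang : Word → Set where
  lang-end  : InLang (⋆ ∷ [])
  lang-step : ∀ {a b n w} → IsUD a → IsUD b → InLang w →
              InLang (⋆ ∷ a ∷ wt n ∷ b ∷ w)

udSubword : Word → Word
udSubword []      = []
udSubword (U ∷ w) = U ∷ udSubword w
udSubword (D ∷ w) = D ∷ udSubword w
udSubword (_ ∷ w) = udSubword w

IsDyck : Word → Set
IsDyck v = (∀ i → countU (take i v) ≤ countD (take i v)) × countU v ≡ countD v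

WeightsOK : Word → Set
WeightsOK w = ∀ i n → at w i ≡ just (wt n) → n < ch i w

IsWDW : Word → Set
IsWDW w = InLang w × IsDyck (udSubword w) × WeightsOK w

maximalᵇ : Word → ℕ → Bool
maximalᵇ w i with at w i
... | just (wt n) = suc n ≡ᵇ ch i w
... | _           = false

precededByDᵇ : Word → ℕ → Bool
precededByDᵇ w zero    = false
precededByDᵇ w (suc i) with at w i
... | just D = true
... | _      = false

eligibleᵇ : Word → ℕ → Bool
eligibleᵇ w i = maximalᵇ w i ∧ precededByDᵇ w i

findLast : (ℕ → Bool) → ℕ → Maybe ℕ
findLast p zero    = nothing
findLast p (suc n) = if p n then just n else findLast p n

findFirstFrom : (ℕ → Bool) → ℕ → ℕ → Maybe ℕ
findFirstFrom p a zero    = nothing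
findFirstFrom p a (suc n) = if p a then just a else findFirstFrom p (suc a) n

special : Word → Maybe ℕ
special w = findLast (eligibleᵇ w) (length w)

starPos : Word → ℕ → Maybe ℕ
starPos w j = findFirstFrom (λ i → isStarAt i ∧ (countStar (take i w) ≡ᵇ j)) 0 (length w)
  where
  isStarAt : ℕ → Bool
  isStarAt i with at w i
  ... | just ⋆ = true
  ... | _      = false

-- Column addition at the ⋆ at position p: replace it by ⋆ D m U ⋆ where
-- m = (column height of the new weight) − 1, i.e. the new weight is maximal.

columnAddition : Word → ℕ → Word
columnAddition w p = pre ++ ⋆ ∷ D ∷ wt m ∷ U ∷ ⋆ ∷ drop (suc p) w
  where
  pre = take p w
  m   = chPre (pre ++ ⋆ ∷ D ∷ []) ∸ 1

insert : Word → ℕ → Maybe Word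
insert w j with starPos w j
... | nothing = nothing
... | just p with special w
...   | nothing = just (columnAddition w p)
...   | just s  = just (if p <ᵇ s
                          -- ribbon addition: U following the new weight
                          -- (position p+3) and D preceding s (now at s+3)
                          then swap (columnAddition w p) (p + 3) (s + 3)
                          else columnAddition w p)

-- Inverse insertion procedure: returns the smaller word and the index
-- (among the letters ⋆, 0-based) of the ⋆ replacing the factor ⋆ D s U ⋆.
invert : Word → Maybe (Word × ℕ)
invert w with special w
... | nothing = nothing
... | just s with at w (suc s)
...   | just D with findFirstFrom (maximalᵇ w) (suc s) (length w)
...     | nothing = nothing
...     | just m  = just (removeFactor (swap w (suc s) (m ∸ 1)) s)
  where
  removeFactor : Word → ℕ → Word × ℕ
  removeFactor v s = (take (s ∸ 2) v ++ ⋆ ∷ drop (s + 3) v) , countStar (take (s ∸ 2) v)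
invert w | just s | _ = just ((take (s ∸ 2) w ++ ⋆ ∷ drop (s + 3) w) , countStar (take (s ∸ 2) w))

-- A weighted Dyck word is a sequence of blocks ⋆ a n b (a, b ∈ {U, D}) closed
-- by a last ⋆, and reads as a lattice walk: between blocks the excess
-- #D − #U is even, say 2g, and the block a n b is a step from level g whose
-- weight lies below the column height.  Maximality and eligibility of a weight
-- then depend only on its block and the level it starts from, and the special
-- weight is the weight h of the last block D h _ starting at level h.
-- Inserting at a ⋆ to the right of the special weight adds the block D g U at
-- the current level g; it becomes the special weight and is followed by U, so
-- the inverse procedure simply deletes it.  Inserting to the left adds D g D
-- and turns the special block D h b into U h b; the blocks in between are
-- raised by one level, so none of their weights is maximal any more, and the
-- inverse procedure finds U h b as the first maximal weight after the new
-- special one, turns it back into D h b and deletes D g D.  Conversely, every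
-- word of positive size decomposes around its special block in one of these
-- two ways.

module Submission where

open import Defs
open import Data.Nat.Base using (ℕ; zero; suc; _+_; _∸_; _≤_; _<_; ⌈_/2⌉; _≡ᵇ_; _<ᵇ_; z≤n; s≤s)
open import Data.Nat.Properties
open import Data.Bool.Base using (Bool; true; false; if_then_else_; _∧_; T)
open import Data.Bool.Properties using (∧-zeroʳ; ∧-identityʳ)
open import Data.Unit using (tt)
open import Data.List.Base using (List; []; _∷_; _++_; take; drop; length)
open import Data.List.Properties using (++-assoc; ++-identityʳ; length-++; length-++-≤ˡ; length-++-sucʳ)
open import Data.Maybe.Base using (Maybe; just; nothing)
open import Data.Product.Base using (_×_; _,_; ∃-syntax; proj₂)
open import Data.Sum.Base using (_⊎_; inj₁; inj₂)
open import Data.Empty using (⊥; ⊥-elim)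
open import Relation.Nullary using (yes; no)
open import Relation.Binary.PropositionalEquality
open import Data.Nat.Tactic.RingSolver using (solve-∀)

≡ᵇ-refl : ∀ n → (n ≡ᵇ n) ≡ true
≡ᵇ-refl zero    = refl
≡ᵇ-refl (suc n) = ≡ᵇ-refl n

<⇒≡ᵇ-false : ∀ {m n} → m < n → (m ≡ᵇ n) ≡ false
<⇒≡ᵇ-false {zero}  {suc n} _         = refl
<⇒≡ᵇ-false {suc m} {suc n} (s≤s m<n) = <⇒≡ᵇ-false m<n

≡ᵇ-true⇒≡ : ∀ {m n} → (m ≡ᵇ n) ≡ true → m ≡ n
≡ᵇ-true⇒≡ {m} {n} e = ≡ᵇ⇒≡ m n (subst T (sym e) tt)

<-suc-≢ᵇ⇒< : ∀ {m n} → m < suc n → (m ≡ᵇ n) ≡ false → m < n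
<-suc-≢ᵇ⇒< {m} m<1+n e with m<1+n⇒m<n∨m≡n m<1+n
... | inj₁ m<n  = m<n
... | inj₂ refl with trans (sym (≡ᵇ-refl m)) e
...   | ()

<⇒<ᵇ-true : ∀ {m n} → m < n → (m <ᵇ n) ≡ true
<⇒<ᵇ-true {m} {n} m<n with m <ᵇ n in eq
... | true  = refl
... | false = ⊥-elim (subst T eq (<⇒<ᵇ m<n))

≥⇒<ᵇ-false : ∀ {m n} → n ≤ m → (m <ᵇ n) ≡ false
≥⇒<ᵇ-false {m} {n} n≤m with m <ᵇ n in eq
... | false = refl
... | true  = ⊥-elim (<⇒≱ (<ᵇ⇒< m n (subst T (sym eq) tt)) n≤m)

findLast-cong : ∀ {p q : ℕ → Bool} n → (∀ i → p i ≡ q i) → findLast p n ≡ findLast q n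
findLast-cong zero    e = refl
findLast-cong (suc n) e rewrite e n | findLast-cong n e = refl

findFirstFrom-cong : ∀ {p q : ℕ → Bool} a n → (∀ i → p i ≡ q i) →
                     findFirstFrom p a n ≡ findFirstFrom q a n
findFirstFrom-cong a zero    e = refl
findFirstFrom-cong a (suc n) e rewrite e a | findFirstFrom-cong (suc a) n e = refl

findLast-just : ∀ (p : ℕ → Bool) n s → s < n → p s ≡ true →
                (∀ i → s < i → i < n → p i ≡ false) → findLast p n ≡ just s
findLast-just p (suc n) s s<1+n ps later with m<1+n⇒m<n∨m≡n s<1+n
... | inj₂ refl rewrite ps = refl
... | inj₁ s<n rewrite later n s<n ≤-refl =
  findLast-just p n s s<n ps (λ i s<i i<n → later i s<i (m<n⇒m<1+n i<n))

findLast-nothing : ∀ (p : ℕ → Bool) n → (∀ i → i < n → p i ≡ false) → findLast p n ≡ nothing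
findLast-nothing p zero    none = refl
findLast-nothing p (suc n) none rewrite none n ≤-refl =
  findLast-nothing p n (λ i i<n → none i (m<n⇒m<1+n i<n))

findFirstFrom-just : ∀ (p : ℕ → Bool) a n m → a ≤ m → m < a + n → p m ≡ true →
                     (∀ i → a ≤ i → i < m → p i ≡ false) → findFirstFrom p a n ≡ just m
findFirstFrom-just p a zero m a≤m m<a+0 pm earlier =
  ⊥-elim (<-irrefl refl (≤-trans (subst (m <_) (+-identityʳ a) m<a+0) a≤m))
findFirstFrom-just p a (suc n) m a≤m m<a+1+n pm earlier with m≤n⇒m<n∨m≡n a≤m
... | inj₂ refl rewrite pm = refl
... | inj₁ a<m rewrite earlier a ≤-refl a<m =
  findFirstFrom-just p (suc a) n m a<m (subst (m <_) (+-suc a n) m<a+1+n) pm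
                     (λ i a<i i<m → earlier i (<⇒≤ a<i) i<m)

at-++ʳ : ∀ (X Y : Word) r → at (X ++ Y) (length X + r) ≡ at Y r
at-++ʳ []      Y r = refl
at-++ʳ (x ∷ X) Y r = at-++ʳ X Y r

at-++-length : ∀ (X Y : Word) → at (X ++ Y) (length X) ≡ at Y 0
at-++-length []      Y = refl
at-++-length (x ∷ X) Y = at-++-length X Y

at-++ˡ : ∀ (X Y : Word) r → r < length X → at (X ++ Y) r ≡ at X r
at-++ˡ (x ∷ X) Y zero    _         = refl
at-++ˡ (x ∷ X) Y (suc r) (s≤s r<X) = at-++ˡ X Y r r<X

take-++ʳ : ∀ (X Y : Word) r → take (length X + r) (X ++ Y) ≡ X ++ take r Y
take-++ʳ []      Y r = refl
take-++ʳ (x ∷ X) Y r = cong (x ∷_) (take-++ʳ X Y r)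

take-++-length : ∀ (X Y : Word) → take (length X) (X ++ Y) ≡ X
take-++-length []      Y = refl
take-++-length (x ∷ X) Y = cong (x ∷_) (take-++-length X Y)

take-++ˡ : ∀ (X Y : Word) r → r ≤ length X → take r (X ++ Y) ≡ take r X
take-++ˡ X       Y zero    _         = refl
take-++ˡ (x ∷ X) Y (suc r) (s≤s r≤X) = cong (x ∷_) (take-++ˡ X Y r r≤X)

drop-++ʳ : ∀ (X Y : Word) r → drop (length X + r) (X ++ Y) ≡ drop r Y
drop-++ʳ []      Y r = refl
drop-++ʳ (x ∷ X) Y r = drop-++ʳ X Y r

drop-++-suc-length : ∀ (X : Word) y Y → drop (suc (length X)) (X ++ y ∷ Y) ≡ Y
drop-++-suc-length []      y Y = refl
drop-++-suc-length (x ∷ X) y Y = drop-++-suc-length X y Y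

setAt-++-length : ∀ (X : Word) y Y c → setAt (X ++ y ∷ Y) (length X) c ≡ X ++ c ∷ Y
setAt-++-length []      y Y c = refl
setAt-++-length (x ∷ X) y Y c = cong (x ∷_) (setAt-++-length X y Y c)

setAt-++ʳ : ∀ (X Y : Word) r c → setAt (X ++ Y) (length X + r) c ≡ X ++ setAt Y r c
setAt-++ʳ []      Y r c = refl
setAt-++ʳ (x ∷ X) Y r c = cong (x ∷_) (setAt-++ʳ X Y r c)

swap-defined : ∀ w i j a b → at w i ≡ just a → at w j ≡ just b →
               swap w i j ≡ setAt (setAt w i b) j a
swap-defined w i j a b ai bj with at w i | at w j
swap-defined w i j a b refl refl | just .a | just .b = refl

swap-++ : ∀ (X : Word) a (P : Word) b Q →
          swap (X ++ a ∷ P ++ b ∷ Q) (length X) (suc (length X + length P)) ≡ X ++ b ∷ P ++ a ∷ Q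
swap-++ X a P b Q = begin
    swap (X ++ a ∷ P ++ b ∷ Q) (length X) j
  ≡⟨ swap-defined _ (length X) j a b (at-++-length X _) b-at-j ⟩
    setAt (setAt (X ++ a ∷ P ++ b ∷ Q) (length X) b) j a
  ≡⟨ cong (λ v → setAt v j a) (setAt-++-length X a (P ++ b ∷ Q) b) ⟩
    setAt (X ++ b ∷ P ++ b ∷ Q) j a
  ≡⟨ cong (λ i → setAt (X ++ b ∷ P ++ b ∷ Q) i a) (sym (+-suc (length X) (length P))) ⟩
    setAt (X ++ b ∷ P ++ b ∷ Q) (length X + suc (length P)) a
  ≡⟨ setAt-++ʳ X (b ∷ P ++ b ∷ Q) (suc (length P)) a ⟩
    X ++ b ∷ setAt (P ++ b ∷ Q) (length P) a
  ≡⟨ cong (λ v → X ++ b ∷ v) (setAt-++-length P b Q a) ⟩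
    X ++ b ∷ P ++ a ∷ Q ∎
  where
  open ≡-Reasoning
  j = suc (length X + length P)
  b-at-j : at (X ++ a ∷ P ++ b ∷ Q) j ≡ just b
  b-at-j = trans (cong (at (X ++ a ∷ P ++ b ∷ Q)) (sym (+-suc (length X) (length P))))
                 (trans (at-++ʳ X _ (suc (length P))) (at-++-length P (b ∷ Q)))

countD-++ : ∀ (X Y : Word) → countD (X ++ Y) ≡ countD X + countD Y
countD-++ []      Y = refl
countD-++ (x ∷ X) Y rewrite countD-++ X Y = sym (+-assoc (if isD x then 1 else 0) (countD X) (countD Y))

countU-++ : ∀ (X Y : Word) → countU (X ++ Y) ≡ countU X + countU Y
countU-++ []      Y = refl
countU-++ (x ∷ X) Y rewrite countU-++ X Y = sym (+-assoc (if isU x then 1 else 0) (countU X) (countU Y))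

data Block : Set where
  block : Bool → ℕ → Bool → Block

letter : Bool → Letter
letter true  = D
letter false = U

blockLetters : List Block → Word
blockLetters []                 = []
blockLetters (block a n b ∷ bs) = ⋆ ∷ letter a ∷ wt n ∷ letter b ∷ blockLetters bs

⟦_⟧ : List Block → Word
⟦ bs ⟧ = blockLetters bs ++ ⋆ ∷ []

width : List Block → ℕ
width bs = length (blockLetters bs)

blockLetters-++ : ∀ bs cs → blockLetters (bs ++ cs) ≡ blockLetters bs ++ blockLetters cs
blockLetters-++ []                 cs = refl
blockLetters-++ (block a n b ∷ bs) cs = cong (λ v → ⋆ ∷ letter a ∷ wt n ∷ letter b ∷ v) (blockLetters-++ bs cs)

⟦⟧-++ : ∀ bs cs → ⟦ bs ++ cs ⟧ ≡ blockLetters bs ++ ⟦ cs ⟧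
⟦⟧-++ bs cs = trans (cong (_++ ⋆ ∷ []) (blockLetters-++ bs cs)) (++-assoc (blockLetters bs) (blockLetters cs) (⋆ ∷ []))

width-++ : ∀ bs cs → width (bs ++ cs) ≡ width bs + width cs
width-++ bs cs = trans (cong length (blockLetters-++ bs cs)) (length-++ (blockLetters bs))

⟦_⟧⁺ : List Block → Word
⟦ [] ⟧⁺                = []
⟦ block a n b ∷ bs ⟧⁺ = letter a ∷ wt n ∷ letter b ∷ ⟦ bs ⟧

⟦⟧-head : ∀ bs → ⟦ bs ⟧ ≡ ⋆ ∷ ⟦ bs ⟧⁺
⟦⟧-head []                 = refl
⟦⟧-head (block a n b ∷ bs) = refl

at-⟦⟧-head : ∀ bs → at ⟦ bs ⟧ 0 ≡ just ⋆
at-⟦⟧-head bs rewrite ⟦⟧-head bs = refl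

-- Levels are half the excess #D − #U at block boundaries.  The column height
-- at the weight of a block starting at level g is g + 1 after D and g after U.
data Step : ℕ → Block → ℕ → Set where
  DD : ∀ {g n} → n < suc g → Step g (block true n true) (suc g)
  DU : ∀ {g n} → n < suc g → Step g (block true n false) g
  UD : ∀ {g n} → n < suc g → Step (suc g) (block false n true) (suc g)
  UU : ∀ {g n} → n < suc g → Step (suc g) (block false n false) g

data Walk (f : ℕ → Block → Bool) : ℕ → List Block → ℕ → Set where
  []   : ∀ {g} → Walk f g [] g
  cons : ∀ {g x g' xs g''} → Step g x g' → f g x ≡ false → Walk f g' xs g'' → Walk f g (x ∷ xs) g''

never : ℕ → Block → Bool
never _ _ = false

Valid : ℕ → List Block → ℕ → Set
Valid = Walk never

maximalBlock eligibleBlock : ℕ → Block → Bool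
maximalBlock  g (block true  n _) = n ≡ᵇ g
maximalBlock  g (block false n _) = suc n ≡ᵇ g
eligibleBlock g (block true  n _) = n ≡ᵇ g
eligibleBlock g (block false _ _) = false

Walk-++ : ∀ {f g xs g₁ ys g₂} → Walk f g xs g₁ → Walk f g₁ ys g₂ → Walk f g (xs ++ ys) g₂
Walk-++ []           q = q
Walk-++ (cons s e p) q = cons s e (Walk-++ p q)

Walk-split : ∀ {f g} xs {ys g₂} → Walk f g (xs ++ ys) g₂ → ∃[ g₁ ] (Walk f g xs g₁ × Walk f g₁ ys g₂)
Walk-split []       p            = _ , [] , p
Walk-split (x ∷ xs) (cons s e p) with Walk-split xs p
... | g₁ , p₁ , p₂ = g₁ , cons s e p₁ , p₂

Walk-map : ∀ {f f' g xs g'} → (∀ h x → f h x ≡ false → f' h x ≡ false) → Walk f g xs g' → Walk f' g xs g'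
Walk-map f⇒f' []           = []
Walk-map f⇒f' (cons s e p) = cons s (f⇒f' _ _ e) (Walk-map f⇒f' p)

toValid : ∀ {f g xs g'} → Walk f g xs g' → Valid g xs g'
toValid = Walk-map (λ _ _ _ → refl)

record Climb (g : ℕ) (X : Word) (g' : ℕ) : Set where
  constructor climb
  field climb-eq : g + g + countD X ≡ g' + g' + countU X
open Climb

climb-++ : ∀ {g X g₁ Y g₂} → Climb g X g₁ → Climb g₁ Y g₂ → Climb g (X ++ Y) g₂
climb-++ {g} {X} {g₁} {Y} {g₂} (climb e₁) (climb e₂) = climb (begin
    g + g + countD (X ++ Y)
  ≡⟨ cong (g + g +_) (countD-++ X Y) ⟩
    g + g + (countD X + countD Y)
  ≡⟨ sym (+-assoc (g + g) (countD X) (countD Y)) ⟩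
    g + g + countD X + countD Y
  ≡⟨ cong (_+ countD Y) e₁ ⟩
    g₁ + g₁ + countU X + countD Y
  ≡⟨ shuffle g₁ (countU X) (countD Y) ⟩
    countU X + (g₁ + g₁ + countD Y)
  ≡⟨ cong (countU X +_) e₂ ⟩
    countU X + (g₂ + g₂ + countU Y)
  ≡⟨ sym (shuffle g₂ (countU X) (countU Y)) ⟩
    g₂ + g₂ + countU X + countU Y
  ≡⟨ +-assoc (g₂ + g₂) (countU X) (countU Y) ⟩
    g₂ + g₂ + (countU X + countU Y)
  ≡⟨ cong (g₂ + g₂ +_) (sym (countU-++ X Y)) ⟩
    g₂ + g₂ + countU (X ++ Y) ∎)
  where
  open ≡-Reasoning
  shuffle : ∀ a b c → a + a + b + c ≡ b + (a + a + c)
  shuffle = solve-∀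

climb-step : ∀ {g x g'} → Step g x g' → Climb g (blockLetters (x ∷ [])) g'
climb-step {g} (DD _) = climb (two-up g)
  where two-up : ∀ g → g + g + 2 ≡ suc g + suc g + 0
        two-up = solve-∀
climb-step (DU _) = climb refl
climb-step (UD _) = climb refl
climb-step {suc g} (UU _) = climb (two-down g)
  where two-down : ∀ g → suc g + suc g + 0 ≡ g + g + 2
        two-down = solve-∀

climb-walk : ∀ {f g xs g'} → Walk f g xs g' → Climb g (blockLetters xs) g'
climb-walk [] = climb refl
climb-walk {xs = block a n b ∷ xs} (cons s _ p) = climb-++ {X = blockLetters (block a n b ∷ [])} (climb-step s) (climb-walk p)

-- column height of the position after Y, when Y starts at level g
heightFrom : ℕ → Word → ℕ
heightFrom g Y = ⌈ (g + g + countD Y) ∸ countU Y /2⌉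

heightFrom-climb : ∀ {g X g'} Y → Climb g X g' → heightFrom g (X ++ Y) ≡ heightFrom g' Y
heightFrom-climb {g} {X} {g'} Y (climb e) = cong ⌈_/2⌉ (begin
    (g + g + countD (X ++ Y)) ∸ countU (X ++ Y)
  ≡⟨ cong₂ _∸_ (cong (g + g +_) (countD-++ X Y)) (countU-++ X Y) ⟩
    (g + g + (countD X + countD Y)) ∸ (countU X + countU Y)
  ≡⟨ cong (_∸ (countU X + countU Y)) (begin
         g + g + (countD X + countD Y)  ≡⟨ sym (+-assoc (g + g) (countD X) (countD Y)) ⟩
         g + g + countD X + countD Y    ≡⟨ cong (_+ countD Y) e ⟩
         g' + g' + countU X + countD Y  ≡⟨ shuffle g' (countU X) (countD Y) ⟩
         countU X + (g' + g' + countD Y) ∎) ⟩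
    (countU X + (g' + g' + countD Y)) ∸ (countU X + countU Y)
  ≡⟨ [m+n]∸[m+o]≡n∸o (countU X) _ _ ⟩
    (g' + g' + countD Y) ∸ countU Y ∎)
  where
  open ≡-Reasoning
  shuffle : ∀ a b c → a + a + b + c ≡ b + (a + a + c)
  shuffle = solve-∀

⌈n+n+1/2⌉≡1+n : ∀ n → ⌈ n + n + 1 /2⌉ ≡ suc n
⌈n+n+1/2⌉≡1+n n = trans (cong ⌈_/2⌉ (+-comm (n + n) 1)) (cong suc (sym (n≡⌊n+n/2⌋ n)))

heightFrom-D : ∀ g → heightFrom g (⋆ ∷ D ∷ []) ≡ suc g
heightFrom-D = ⌈n+n+1/2⌉≡1+n

heightFrom-U : ∀ g → heightFrom (suc g) (⋆ ∷ U ∷ []) ≡ suc g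
heightFrom-U g = trans (cong (λ k → ⌈ k ∸ 1 /2⌉) (odd g)) (⌈n+n+1/2⌉≡1+n g)
  where odd : ∀ g → suc g + suc g + 0 ≡ suc (g + g + 1)
        odd = solve-∀

maximalLetter : Maybe Letter → ℕ → Bool
maximalLetter (just (wt n)) c = suc n ≡ᵇ c
maximalLetter _             c = false

maximalLetter-letter : ∀ a c → maximalLetter (just (letter a)) c ≡ false
maximalLetter-letter true  c = refl
maximalLetter-letter false c = refl

isDLetter : Maybe Letter → Bool
isDLetter (just D) = true
isDLetter _        = false

precededByD : Word → ℕ → Bool
precededByD Y zero    = false
precededByD Y (suc r) = isDLetter (at Y r)

maximalFrom eligibleFrom : ℕ → Word → ℕ → Bool
maximalFrom  g Y r = maximalLetter (at Y r) (heightFrom g (take r Y))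
eligibleFrom g Y r = maximalFrom g Y r ∧ precededByD Y r

maximalᵇ≡maximalFrom : ∀ w i → maximalᵇ w i ≡ maximalFrom 0 w i
maximalᵇ≡maximalFrom w i with at w i
... | just (wt n) = refl
... | just ⋆      = refl
... | just U      = refl
... | just D      = refl
... | nothing     = refl

precededByDᵇ≡precededByD : ∀ w i → precededByDᵇ w i ≡ precededByD w i
precededByDᵇ≡precededByD w zero    = refl
precededByDᵇ≡precededByD w (suc i) with at w i
... | just (wt n) = refl
... | just ⋆      = refl
... | just U      = refl
... | just D      = refl
... | nothing     = refl

eligibleᵇ≡eligibleFrom : ∀ w i → eligibleᵇ w i ≡ eligibleFrom 0 w i
eligibleᵇ≡eligibleFrom w i = cong₂ _∧_ (maximalᵇ≡maximalFrom w i) (precededByDᵇ≡precededByD w i)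

non-maximal⇒non-eligible : ∀ {g Y r} → maximalFrom g Y r ≡ false → eligibleFrom g Y r ≡ false
non-maximal⇒non-eligible {g} {Y} {r} e = cong (_∧ precededByD Y r) e

maximalFrom-++ : ∀ {g X g'} Y r → Climb g X g' → maximalFrom g (X ++ Y) (length X + r) ≡ maximalFrom g' Y r
maximalFrom-++ {g} {X} Y r c =
  cong₂ maximalLetter (at-++ʳ X Y r) (trans (cong (heightFrom g) (take-++ʳ X Y r)) (heightFrom-climb (take r Y) c))

-- the ⋆ heading Y rules out that its first letter is eligible
eligibleFrom-++ : ∀ {g X g'} Y r → Climb g X g' → at Y 0 ≡ just ⋆ →
                  eligibleFrom g (X ++ Y) (length X + r) ≡ eligibleFrom g' Y r
eligibleFrom-++ {g} {X} {g'} Y zero c ⋆-head rewrite maximalFrom-++ Y 0 c | ⋆-head = refl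
eligibleFrom-++ {g} {X} Y (suc r) c ⋆-head =
  cong₂ _∧_ (maximalFrom-++ Y (suc r) c)
            (trans (cong (precededByD (X ++ Y)) (+-suc (length X) r)) (cong isDLetter (at-++ʳ X Y r)))

maximalFrom-weight : ∀ {g x g'} Z → Step g x g' → maximalFrom g (blockLetters (x ∷ []) ++ Z) 2 ≡ maximalBlock g x
maximalFrom-weight {g} Z (DD _) rewrite heightFrom-D g = refl
maximalFrom-weight {g} Z (DU _) rewrite heightFrom-D g = refl
maximalFrom-weight {suc g} Z (UD _) rewrite heightFrom-U g = refl
maximalFrom-weight {suc g} Z (UU _) rewrite heightFrom-U g = refl

eligibleFrom-weight : ∀ {g x g'} Z → Step g x g' → eligibleFrom g (blockLetters (x ∷ []) ++ Z) 2 ≡ eligibleBlock g x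
eligibleFrom-weight {g} Z (DD {n = n} _) rewrite heightFrom-D g = ∧-identityʳ (n ≡ᵇ g)
eligibleFrom-weight {g} Z (DU {n = n} _) rewrite heightFrom-D g = ∧-identityʳ (n ≡ᵇ g)
eligibleFrom-weight {suc g} Z (UD {n = n} _) = ∧-zeroʳ (maximalFrom (suc g) (blockLetters (block false n true ∷ []) ++ Z) 2)
eligibleFrom-weight {suc g} Z (UU {n = n} _) = ∧-zeroʳ (maximalFrom (suc g) (blockLetters (block false n false ∷ []) ++ Z) 2)

maximalFrom-avoiding : ∀ {g xs g'} → Walk maximalBlock g xs g' →
                       ∀ Z r → r < width xs → maximalFrom g (blockLetters xs ++ Z) r ≡ false
maximalFrom-avoiding (cons {x = block a n b} s e p) Z 0 _ = refl
maximalFrom-avoiding (cons {x = block a n b} s e p) Z 1 _ = maximalLetter-letter a _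
maximalFrom-avoiding (cons {x = block a n b} {xs = xs} s e p) Z 2 _ = trans (maximalFrom-weight (blockLetters xs ++ Z) s) e
maximalFrom-avoiding (cons {x = block a n b} s e p) Z 3 _ = maximalLetter-letter b _
maximalFrom-avoiding (cons {x = block a n b} {xs = xs} s e p) Z (suc (suc (suc (suc r)))) (s≤s (s≤s (s≤s (s≤s r<)))) =
  trans (maximalFrom-++ (blockLetters xs ++ Z) r (climb-step s)) (maximalFrom-avoiding p Z r r<)

eligibleFrom-avoiding : ∀ {g xs g'} → Walk eligibleBlock g xs g' → ∀ r → eligibleFrom g ⟦ xs ⟧ r ≡ false
eligibleFrom-avoiding [] zero    = refl
eligibleFrom-avoiding [] (suc r) = refl
eligibleFrom-avoiding (cons {x = block a n b} s e p) 0 = refl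
eligibleFrom-avoiding {g} (cons {x = block a n b} {xs = xs} s e p) 1 =
  non-maximal⇒non-eligible {g} {⟦ block a n b ∷ xs ⟧} {1} (maximalLetter-letter a _)
eligibleFrom-avoiding (cons {x = block a n b} {xs = xs} s e p) 2 = trans (eligibleFrom-weight ⟦ xs ⟧ s) e
eligibleFrom-avoiding {g} (cons {x = block a n b} {xs = xs} s e p) 3 =
  non-maximal⇒non-eligible {g} {⟦ block a n b ∷ xs ⟧} {3} (maximalLetter-letter b _)
eligibleFrom-avoiding (cons {x = block a n b} {xs = xs} s e p) (suc (suc (suc (suc r)))) =
  trans (eligibleFrom-++ ⟦ xs ⟧ r (climb-step s) (at-⟦⟧-head xs)) (eligibleFrom-avoiding p r)

special≡findLast : ∀ w → special w ≡ findLast (eligibleFrom 0 w) (length w)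
special≡findLast w = findLast-cong (length w) (eligibleᵇ≡eligibleFrom w)

special-none : ∀ {bs g'} → Walk eligibleBlock 0 bs g' → special ⟦ bs ⟧ ≡ nothing
special-none {bs} p = trans (special≡findLast ⟦ bs ⟧)
  (findLast-nothing _ (length ⟦ bs ⟧) (λ i _ → eligibleFrom-avoiding p i))

special-at : ∀ {es h b h' fs g'} → Valid 0 es h → Step h (block true h b) h' → Walk eligibleBlock h' fs g' →
             special ⟦ es ++ block true h b ∷ fs ⟧ ≡ just (width es + 2)
special-at {es} {h} {b} {h'} {fs} ves s p =
  trans (cong special (⟦⟧-++ es (block true h b ∷ fs)))
    (trans (special≡findLast W)
      (findLast-just (eligibleFrom 0 W) (length W) (width es + 2) in-range eligible later-not))
  where
  Y = blockLetters (block true h b ∷ []) ++ ⟦ fs ⟧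
  W = blockLetters es ++ Y
  in-range : width es + 2 < length W
  in-range = subst (width es + 2 <_) (sym (length-++ (blockLetters es) {Y}))
               (+-monoʳ-< (width es) (s≤s (s≤s (s≤s z≤n))))
  eligible : eligibleFrom 0 W (width es + 2) ≡ true
  eligible = trans (eligibleFrom-++ Y 2 (climb-walk ves) refl) (trans (eligibleFrom-weight ⟦ fs ⟧ s) (≡ᵇ-refl h))
  after-weight : ∀ t → eligibleFrom h Y (3 + t) ≡ false
  after-weight zero    = non-maximal⇒non-eligible {h} {Y} {3} (maximalLetter-letter b _)
  after-weight (suc t) = trans (eligibleFrom-++ ⟦ fs ⟧ t (climb-step s) (at-⟦⟧-head fs)) (eligibleFrom-avoiding p t)
  later-not : ∀ i → width es + 2 < i → i < length W → eligibleFrom 0 W i ≡ false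
  later-not i s<i _ with m≤n⇒∃[o]m+o≡n s<i
  ... | t , refl = trans (cong (eligibleFrom 0 W) (shuffle (width es) t))
                     (trans (eligibleFrom-++ Y (3 + t) (climb-walk ves) refl) (after-weight t))
    where
    shuffle : ∀ a t → suc (a + 2) + t ≡ a + (3 + t)
    shuffle = solve-∀

isStarLetter : Maybe Letter → Bool
isStarLetter (just ⋆) = true
isStarLetter _        = false

isJthStar : Word → ℕ → ℕ → Bool
isJthStar w j i = isStarLetter (at w i) ∧ (countStar (take i w) ≡ᵇ j)

-- The predicate searched by starPos is local to its where-block, so the
-- left-hand side of starPos-pointwise is left to unification.
mutual
  starPos≡findFirstFrom : ∀ w j → starPos w j ≡ findFirstFrom (isJthStar w j) 0 (length w)
  starPos≡findFirstFrom w j = findFirstFrom-cong 0 (length w) (starPos-pointwise w j)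

  starPos-pointwise : ∀ w j i → _ ≡ isStarLetter (at w i) ∧ (countStar (take i w) ≡ᵇ j)
  starPos-pointwise w j i with at w i
  ... | just ⋆      = refl
  ... | just U      = refl
  ... | just D      = refl
  ... | just (wt _) = refl
  ... | nothing     = refl

isStar-letter : ∀ a → isStar (letter a) ≡ false
isStar-letter true  = refl
isStar-letter false = refl

countStar-blockLetters : ∀ cs → countStar (blockLetters cs) ≡ length cs
countStar-blockLetters [] = refl
countStar-blockLetters (block a n b ∷ cs) rewrite isStar-letter a | isStar-letter b = cong suc (countStar-blockLetters cs)

isJthStar-blockLetters : ∀ cs i → i < width cs → isJthStar (blockLetters cs) (length cs) i ≡ false
isJthStar-blockLetters (block a n b ∷ cs) 0 _ = refl
isJthStar-blockLetters (block true  n b ∷ cs) 1 _ = refl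
isJthStar-blockLetters (block false n b ∷ cs) 1 _ = refl
isJthStar-blockLetters (block a n b ∷ cs) 2 _ = refl
isJthStar-blockLetters (block a n true  ∷ cs) 3 _ = refl
isJthStar-blockLetters (block a n false ∷ cs) 3 _ = refl
isJthStar-blockLetters (block a n b ∷ cs) (suc (suc (suc (suc i)))) (s≤s (s≤s (s≤s (s≤s i<)))) =
  trans (next-block a b) (isJthStar-blockLetters cs i i<)
  where
  next-block : ∀ a b → isJthStar (blockLetters (block a n b ∷ cs)) (suc (length cs)) (4 + i)
                       ≡ isJthStar (blockLetters cs) (length cs) i
  next-block true  true  = refl
  next-block true  false = refl
  next-block false true  = refl
  next-block false false = refl

starPos-⟦⟧ : ∀ cs ds → starPos ⟦ cs ++ ds ⟧ (length cs) ≡ just (width cs)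
starPos-⟦⟧ cs ds =
  trans (cong (λ w → starPos w (length cs)) (⟦⟧-++ cs ds))
   (trans (starPos≡findFirstFrom W (length cs))
     (findFirstFrom-just _ 0 (length W) (width cs) z≤n in-range star earlier-not))
  where
  W = blockLetters cs ++ ⟦ ds ⟧
  in-range : width cs < length W
  in-range rewrite length-++ (blockLetters cs) {⟦ ds ⟧} | ⟦⟧-head ds = m<m+n (width cs) (s≤s z≤n)
  star : isJthStar W (length cs) (width cs) ≡ true
  star rewrite at-++-length (blockLetters cs) ⟦ ds ⟧ | at-⟦⟧-head ds
             | take-++-length (blockLetters cs) ⟦ ds ⟧ | countStar-blockLetters cs = ≡ᵇ-refl (length cs)
  earlier-not : ∀ i → 0 ≤ i → i < width cs → isJthStar W (length cs) i ≡ false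
  earlier-not i _ i< rewrite at-++ˡ (blockLetters cs) ⟦ ds ⟧ i i< | take-++ˡ (blockLetters cs) ⟦ ds ⟧ i (<⇒≤ i<) =
    isJthStar-blockLetters cs i i<

size-⟦⟧ : ∀ bs → size ⟦ bs ⟧ ≡ length bs
size-⟦⟧ [] = refl
size-⟦⟧ (block true  n true  ∷ bs) = cong suc (size-⟦⟧ bs)
size-⟦⟧ (block true  n false ∷ bs) = cong suc (size-⟦⟧ bs)
size-⟦⟧ (block false n true  ∷ bs) = cong suc (size-⟦⟧ bs)
size-⟦⟧ (block false n false ∷ bs) = cong suc (size-⟦⟧ bs)

isUD-letter : ∀ {a} → IsUD a → ∃[ a' ] letter a' ≡ a
isUD-letter isU' = false , refl
isUD-letter isD' = true , refl

inLang⇒⟦⟧ : ∀ {w} → InLang w → ∃[ bs ] (w ≡ ⟦ bs ⟧)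
inLang⇒⟦⟧ lang-end = [] , refl
inLang⇒⟦⟧ (lang-step {n = n} ua ub l) with isUD-letter ua | isUD-letter ub | inLang⇒⟦⟧ l
... | a , refl | b , refl | bs , refl = block a n b ∷ bs , refl

letter-isUD : ∀ a → IsUD (letter a)
letter-isUD true  = isD'
letter-isUD false = isU'

⟦⟧-inLang : ∀ bs → InLang ⟦ bs ⟧
⟦⟧-inLang []                 = lang-end
⟦⟧-inLang (block a n b ∷ bs) = lang-step (letter-isUD a) (letter-isUD b) (⟦⟧-inLang bs)

udLetters : List Block → Word
udLetters []                 = []
udLetters (block a n b ∷ bs) = letter a ∷ letter b ∷ udLetters bs

udSubword-⟦⟧ : ∀ bs → udSubword ⟦ bs ⟧ ≡ udLetters bs
udSubword-⟦⟧ [] = refl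
udSubword-⟦⟧ (block true  n true  ∷ bs) = cong (λ v → D ∷ D ∷ v) (udSubword-⟦⟧ bs)
udSubword-⟦⟧ (block true  n false ∷ bs) = cong (λ v → D ∷ U ∷ v) (udSubword-⟦⟧ bs)
udSubword-⟦⟧ (block false n true  ∷ bs) = cong (λ v → U ∷ D ∷ v) (udSubword-⟦⟧ bs)
udSubword-⟦⟧ (block false n false ∷ bs) = cong (λ v → U ∷ U ∷ v) (udSubword-⟦⟧ bs)

countD-udLetters : ∀ bs → countD (udLetters bs) ≡ countD (blockLetters bs)
countD-udLetters [] = refl
countD-udLetters (block a n b ∷ bs) =
  cong (λ k → (if isD (letter a) then 1 else 0) + ((if isD (letter b) then 1 else 0) + k)) (countD-udLetters bs)

countU-udLetters : ∀ bs → countU (udLetters bs) ≡ countU (blockLetters bs)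
countU-udLetters [] = refl
countU-udLetters (block a n b ∷ bs) =
  cong (λ k → (if isU (letter a) then 1 else 0) + ((if isU (letter b) then 1 else 0) + k)) (countU-udLetters bs)

Balanced : Word → Set
Balanced w = countU (udSubword w) ≡ countD (udSubword w)

balanced⇒level-0 : ∀ {cs g} → Valid 0 cs g → Balanced ⟦ cs ⟧ → g ≡ 0
balanced⇒level-0 {cs} {g} vcs balanced = m+n≡0⇒m≡0 g (+-cancelʳ-≡ u (g + g) 0 (sym u≡g+g+u))
  where
  u = countU (blockLetters cs)
  u≡g+g+u : u ≡ g + g + u
  u≡g+g+u = begin
      u                                   ≡⟨ sym (countU-udLetters cs) ⟩
      countU (udLetters cs)               ≡⟨ cong countU (sym (udSubword-⟦⟧ cs)) ⟩
      countU (udSubword ⟦ cs ⟧)           ≡⟨ balanced ⟩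
      countD (udSubword ⟦ cs ⟧)           ≡⟨ cong countD (udSubword-⟦⟧ cs) ⟩
      countD (udLetters cs)               ≡⟨ countD-udLetters cs ⟩
      countD (blockLetters cs)            ≡⟨ climb-eq (climb-walk vcs) ⟩
      g + g + u                           ∎
    where open ≡-Reasoning

step-below-height : ∀ g a n b → n < heightFrom g (⋆ ∷ letter a ∷ []) → ∃[ g' ] Step g (block a n b) g'
step-below-height g       true  n true  n< = suc g , DD (subst (n <_) (heightFrom-D g) n<)
step-below-height g       true  n false n< = g , DU (subst (n <_) (heightFrom-D g) n<)
step-below-height zero    false n b     ()
step-below-height (suc g) false n true  n< = suc g , UD (subst (n <_) (heightFrom-U g) n<)
step-below-height (suc g) false n false n< = g , UU (subst (n <_) (heightFrom-U g) n<)

valid-suffix : ∀ ds {cs g} → Valid 0 cs g → WeightsOK ⟦ cs ++ ds ⟧ → Balanced ⟦ cs ++ ds ⟧ → Valid g ds 0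
valid-suffix [] {cs} vcs _ balanced
  with balanced⇒level-0 vcs (subst (λ z → Balanced ⟦ z ⟧) (++-identityʳ cs) balanced)
... | refl = []
valid-suffix (block a n b ∷ ds) {cs} {g} vcs weights balanced =
  cons step refl (valid-suffix ds (Walk-++ vcs (cons step refl [])) (moved WeightsOK weights) (moved Balanced balanced))
  where
  Y = ⋆ ∷ letter a ∷ wt n ∷ letter b ∷ ⟦ ds ⟧
  bound : n < heightFrom g (⋆ ∷ letter a ∷ [])
  bound = subst (n <_) (trans (cong chPre (take-++ʳ (blockLetters cs) Y 2)) (heightFrom-climb (take 2 Y) (climb-walk vcs)))
            (subst WeightsOK (⟦⟧-++ cs (block a n b ∷ ds)) weights (width cs + 2) n (at-++ʳ (blockLetters cs) Y 2))
  step = proj₂ (step-below-height g a n b bound)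
  moved : (P : Word → Set) → P ⟦ cs ++ block a n b ∷ ds ⟧ → P ⟦ (cs ++ block a n b ∷ []) ++ ds ⟧
  moved P = subst (λ z → P ⟦ z ⟧) (sym (++-assoc cs (block a n b ∷ []) ds))

wdw⇒valid : ∀ {w} → IsWDW w → ∃[ bs ] (w ≡ ⟦ bs ⟧ × Valid 0 bs 0)
wdw⇒valid (lang , (_ , balanced) , weights) with inLang⇒⟦⟧ lang
... | bs , refl = bs , refl , valid-suffix bs [] weights balanced

udLetters-prefix : ∀ {f g bs g'} → Walk f g bs g' →
                   ∀ i → countU (take i (udLetters bs)) ≤ g + g + countD (take i (udLetters bs))
udLetters-prefix []                   zero          = z≤n
udLetters-prefix []                   (suc i)       = z≤n
udLetters-prefix (cons _ _ _)         zero          = z≤n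
udLetters-prefix (cons (DD _) _ _)    (suc zero)    = z≤n
udLetters-prefix (cons (DU _) _ _)    (suc zero)    = z≤n
udLetters-prefix (cons (UD _) _ _)    (suc zero)    = s≤s z≤n
udLetters-prefix (cons (UU _) _ _)    (suc zero)    = s≤s z≤n
udLetters-prefix {g = g} (cons {xs = xs} (DD _) _ p) (suc (suc i)) =
  subst (countU (take i (udLetters xs)) ≤_) (up g (countD (take i (udLetters xs)))) (udLetters-prefix p i)
  where up : ∀ g d → suc g + suc g + d ≡ g + g + suc (suc d)
        up = solve-∀
udLetters-prefix {g = g} (cons {xs = xs} (DU _) _ p) (suc (suc i)) =
  subst (suc (countU (take i (udLetters xs))) ≤_) (sym (+-suc (g + g) _)) (s≤s (udLetters-prefix p i))
udLetters-prefix {g = g} (cons {xs = xs} (UD _) _ p) (suc (suc i)) =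
  subst (suc (countU (take i (udLetters xs))) ≤_) (sym (+-suc (g + g) _)) (s≤s (udLetters-prefix p i))
udLetters-prefix {g = suc g} (cons {xs = xs} (UU _) _ p) (suc (suc i)) =
  subst (suc (suc (countU (take i (udLetters xs)))) ≤_) (down g (countD (take i (udLetters xs))))
        (s≤s (s≤s (udLetters-prefix p i)))
  where down : ∀ g d → suc (suc (g + g + d)) ≡ suc g + suc g + d
        down = solve-∀

weights-below : ∀ {f g bs g'} → Walk f g bs g' → ∀ i n → at ⟦ bs ⟧ i ≡ just (wt n) → n < heightFrom g (take i ⟦ bs ⟧)
weights-below {g = g}     (cons (DD n<) _ _) 2 n refl = subst (n <_) (sym (heightFrom-D g)) n<
weights-below {g = g}     (cons (DU n<) _ _) 2 n refl = subst (n <_) (sym (heightFrom-D g)) n<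
weights-below {g = suc g} (cons (UD n<) _ _) 2 n refl = subst (n <_) (sym (heightFrom-U g)) n<
weights-below {g = suc g} (cons (UU n<) _ _) 2 n refl = subst (n <_) (sym (heightFrom-U g)) n<
weights-below (cons {x = block a m b} {xs = xs} s _ p) (suc (suc (suc (suc i)))) n e =
  subst (n <_) (sym (heightFrom-climb (take i ⟦ xs ⟧) (climb-step s))) (weights-below p i n e)
weights-below [] zero    n ()
weights-below [] (suc i) n ()
weights-below (cons {x = block a m b} s _ _) zero n ()
weights-below (cons {x = block true  m b} s _ _) 1 n ()
weights-below (cons {x = block false m b} s _ _) 1 n ()
weights-below (cons {x = block a m true}  s _ _) 3 n ()
weights-below (cons {x = block a m false} s _ _) 3 n ()

valid⇒wdw : ∀ {bs} → Valid 0 bs 0 → IsWDW ⟦ bs ⟧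
valid⇒wdw {bs} vbs = ⟦⟧-inLang bs , (prefixes , balanced) , weights-below vbs
  where
  prefixes : ∀ i → countU (take i (udSubword ⟦ bs ⟧)) ≤ countD (take i (udSubword ⟦ bs ⟧))
  prefixes i rewrite udSubword-⟦⟧ bs = udLetters-prefix vbs i
  balanced : Balanced ⟦ bs ⟧
  balanced rewrite udSubword-⟦⟧ bs | countD-udLetters bs | countU-udLetters bs = sym (climb-eq (climb-walk vbs))

removeFactor : Word → ℕ → Word × ℕ
removeFactor v s = (take (s ∸ 2) v ++ ⋆ ∷ drop (s + 3) v) , countStar (take (s ∸ 2) v)

insert-without-special : ∀ w j p → starPos w j ≡ just p → special w ≡ nothing →
                         insert w j ≡ just (columnAddition w p)
insert-without-special w j p star-p no-special rewrite star-p | no-special = refl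

insert-right-of-special : ∀ w j p s → starPos w j ≡ just p → special w ≡ just s → s ≤ p →
                          insert w j ≡ just (columnAddition w p)
insert-right-of-special w j p s star-p special-s s≤p rewrite star-p | special-s | ≥⇒<ᵇ-false s≤p = refl

insert-left-of-special : ∀ w j p s → starPos w j ≡ just p → special w ≡ just s → p < s →
                         insert w j ≡ just (swap (columnAddition w p) (p + 3) (s + 3))
insert-left-of-special w j p s star-p special-s p<s rewrite star-p | special-s | <⇒<ᵇ-true p<s = refl

invert-followed-by-U : ∀ w s → special w ≡ just s → at w (suc s) ≡ just U → invert w ≡ just (removeFactor w s)
invert-followed-by-U w s special-s U-after rewrite special-s | U-after = refl

invert-followed-by-D : ∀ w s m → special w ≡ just s → at w (suc s) ≡ just D →
                       findFirstFrom (maximalᵇ w) (suc s) (length w) ≡ just m →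
                       invert w ≡ just (removeFactor (swap w (suc s) (m ∸ 1)) s)
invert-followed-by-D w s m special-s D-after first-m with special w | special-s
... | just .s | refl with at w (suc s) in eq
...   | just D with findFirstFrom (maximalᵇ w) (suc s) (length w) | first-m
...     | just .m | refl rewrite eq = refl

at-after-weight : ∀ cs a n b ds → at ⟦ cs ++ block a n b ∷ ds ⟧ (suc (width cs + 2)) ≡ just (letter b)
at-after-weight cs a n b ds =
  trans (cong₂ at (⟦⟧-++ cs (block a n b ∷ ds)) (sym (+-suc (width cs) 2))) (at-++ʳ (blockLetters cs) _ 3)

columnAddition-⟦⟧ : ∀ {cs g} ds → Valid 0 cs g → columnAddition ⟦ cs ++ ds ⟧ (width cs) ≡ ⟦ cs ++ block true g false ∷ ds ⟧
columnAddition-⟦⟧ {cs} {g} ds vcs = begin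
    columnAddition ⟦ cs ++ ds ⟧ (width cs)
  ≡⟨ cong (λ v → columnAddition v (width cs)) (trans (⟦⟧-++ cs ds) (cong (X ++_) (⟦⟧-head ds))) ⟩
    columnAddition (X ++ ⋆ ∷ ⟦ ds ⟧⁺) (length X)
  ≡⟨ cong₂ (λ A m → A ++ ⋆ ∷ D ∷ wt m ∷ U ∷ ⋆ ∷ drop (suc (length X)) (X ++ ⋆ ∷ ⟦ ds ⟧⁺))
           (take-++-length X (⋆ ∷ ⟦ ds ⟧⁺)) new-weight ⟩
    X ++ ⋆ ∷ D ∷ wt g ∷ U ∷ ⋆ ∷ drop (suc (length X)) (X ++ ⋆ ∷ ⟦ ds ⟧⁺)
  ≡⟨ cong (λ v → X ++ ⋆ ∷ D ∷ wt g ∷ U ∷ v) (trans (cong (⋆ ∷_) (drop-++-suc-length X ⋆ ⟦ ds ⟧⁺)) (sym (⟦⟧-head ds))) ⟩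
    X ++ ⟦ block true g false ∷ ds ⟧
  ≡⟨ sym (⟦⟧-++ cs (block true g false ∷ ds)) ⟩
    ⟦ cs ++ block true g false ∷ ds ⟧ ∎
  where
  open ≡-Reasoning
  X = blockLetters cs
  new-weight : chPre (take (length X) (X ++ ⋆ ∷ ⟦ ds ⟧⁺) ++ ⋆ ∷ D ∷ []) ∸ 1 ≡ g
  new-weight = cong (_∸ 1) (trans (cong (λ A → heightFrom 0 (A ++ ⋆ ∷ D ∷ [])) (take-++-length X (⋆ ∷ ⟦ ds ⟧⁺)))
                                  (trans (heightFrom-climb (⋆ ∷ D ∷ []) (climb-walk vcs)) (heightFrom-D g)))

removeFactor-⟦⟧ : ∀ cs a n b ds → removeFactor ⟦ cs ++ block a n b ∷ ds ⟧ (width cs + 2) ≡ (⟦ cs ++ ds ⟧ , length cs)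
removeFactor-⟦⟧ cs a n b ds
  rewrite ⟦⟧-++ cs (block a n b ∷ ds) | m+n∸n≡m (width cs) 2 | +-assoc (width cs) 2 3
        | take-++-length (blockLetters cs) ⟦ block a n b ∷ ds ⟧ | drop-++ʳ (blockLetters cs) ⟦ block a n b ∷ ds ⟧ 5
  = cong₂ _,_ (trans (cong (λ v → blockLetters cs ++ ⋆ ∷ drop 1 v) (⟦⟧-head ds))
                     (trans (cong (blockLetters cs ++_) (sym (⟦⟧-head ds))) (sym (⟦⟧-++ cs ds))))
              (countStar-blockLetters cs)

swap-⟦⟧ : ∀ cs g a es c t b fs {i j} → i ≡ width cs + 3 → j ≡ suc (width cs + 3 + (width es + 1)) →
          swap ⟦ cs ++ block true g a ∷ es ++ block c t b ∷ fs ⟧ i j ≡ ⟦ cs ++ block true g c ∷ es ++ block a t b ∷ fs ⟧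
swap-⟦⟧ cs g a es c t b fs refl refl = begin
    swap ⟦ cs ++ block true g a ∷ es ++ block c t b ∷ fs ⟧ (width cs + 3) (suc (width cs + 3 + (width es + 1)))
  ≡⟨ cong₂ (swap ⟦ cs ++ block true g a ∷ es ++ block c t b ∷ fs ⟧) (sym length-X) (cong suc (sym (cong₂ _+_ length-X length-P))) ⟩
    swap ⟦ cs ++ block true g a ∷ es ++ block c t b ∷ fs ⟧ (length X) (suc (length X + length P))
  ≡⟨ cong (λ v → swap v (length X) (suc (length X + length P))) (shape a c) ⟩
    swap (X ++ letter a ∷ P ++ letter c ∷ Q) (length X) (suc (length X + length P))
  ≡⟨ swap-++ X (letter a) P (letter c) Q ⟩
    X ++ letter c ∷ P ++ letter a ∷ Q
  ≡⟨ sym (shape c a) ⟩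
    ⟦ cs ++ block true g c ∷ es ++ block a t b ∷ fs ⟧ ∎
  where
  open ≡-Reasoning
  X = blockLetters cs ++ ⋆ ∷ D ∷ wt g ∷ []
  P = blockLetters es ++ ⋆ ∷ []
  Q = wt t ∷ letter b ∷ ⟦ fs ⟧
  length-X : length X ≡ width cs + 3
  length-X = length-++ (blockLetters cs)
  length-P : length P ≡ width es + 1
  length-P = length-++ (blockLetters es)
  shape : ∀ a c → ⟦ cs ++ block true g a ∷ es ++ block c t b ∷ fs ⟧ ≡ X ++ letter a ∷ P ++ letter c ∷ Q
  shape a c = begin
      ⟦ cs ++ block true g a ∷ es ++ block c t b ∷ fs ⟧
    ≡⟨ ⟦⟧-++ cs _ ⟩
      blockLetters cs ++ ⋆ ∷ D ∷ wt g ∷ letter a ∷ ⟦ es ++ block c t b ∷ fs ⟧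
    ≡⟨ cong (λ v → blockLetters cs ++ ⋆ ∷ D ∷ wt g ∷ letter a ∷ v)
            (trans (⟦⟧-++ es _) (sym (++-assoc (blockLetters es) (⋆ ∷ []) (letter c ∷ Q)))) ⟩
      blockLetters cs ++ ⋆ ∷ D ∷ wt g ∷ letter a ∷ P ++ letter c ∷ Q
    ≡⟨ sym (++-assoc (blockLetters cs) (⋆ ∷ D ∷ wt g ∷ []) (letter a ∷ P ++ letter c ∷ Q)) ⟩
      X ++ letter a ∷ P ++ letter c ∷ Q ∎

leftmostMaximal-⟦⟧ : ∀ {cs g es h h'} b fs → Valid 0 cs g → Walk maximalBlock (suc g) es (suc h) →
                     Step (suc h) (block false h b) h' →
                     findFirstFrom (maximalᵇ ⟦ cs ++ block true g true ∷ es ++ block false h b ∷ fs ⟧)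
                                   (suc (width cs + 2)) (length ⟦ cs ++ block true g true ∷ es ++ block false h b ∷ fs ⟧)
                     ≡ just (width cs + 4 + width es + 2)
leftmostMaximal-⟦⟧ {cs} {g} {es} {h} b fs vcs es-not-maximal step-y =
  trans (cong (λ v → findFirstFrom (maximalᵇ v) start (length v)) shape)
   (trans (findFirstFrom-cong start (length W) (maximalᵇ≡maximalFrom W))
     (findFirstFrom-just (maximalFrom 0 W) start (length W) m start≤m m<end maximal-m none-before))
  where
  open ≡-Reasoning
  start = suc (width cs + 2)
  Y₃ = blockLetters (block false h b ∷ []) ++ ⟦ fs ⟧
  Y₂ = blockLetters es ++ Y₃
  Y  = blockLetters (block true g true ∷ []) ++ Y₂
  W  = blockLetters cs ++ Y
  shape : ⟦ cs ++ block true g true ∷ es ++ block false h b ∷ fs ⟧ ≡ W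
  shape = trans (⟦⟧-++ cs _) (cong (λ v → blockLetters cs ++ ⋆ ∷ D ∷ wt g ∷ D ∷ v) (⟦⟧-++ es (block false h b ∷ fs)))
  P = width cs
  E = width es
  m = P + 4 + E + 2
  climb-cs = climb-walk vcs
  climb-x  = climb-step {g} (DD {n = g} ≤-refl)
  climb-es = climb-walk es-not-maximal
  start≤m : start ≤ m
  start≤m = subst (start ≤_) (shift P E) (m≤m+n start (3 + E))
    where shift : ∀ p e → suc (p + 2) + (3 + e) ≡ p + 4 + e + 2
          shift = solve-∀
  m<end : m < start + length W
  m<end = ≤-trans (subst (m <_) (sym length-W) (m≤m+n (suc m) (1 + length ⟦ fs ⟧))) (m≤n+m (length W) start)
    where
    length-W : length W ≡ suc m + (1 + length ⟦ fs ⟧)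
    length-W = begin
        length W                                          ≡⟨ length-++ (blockLetters cs) ⟩
        P + (4 + length Y₂)                               ≡⟨ cong (λ k → P + (4 + k)) (length-++ (blockLetters es)) ⟩
        P + (4 + (E + (4 + length ⟦ fs ⟧)))               ≡⟨ shift P E (length ⟦ fs ⟧) ⟩
        suc m + (1 + length ⟦ fs ⟧)                       ∎
      where shift : ∀ p e r → p + (4 + (e + (4 + r))) ≡ suc (p + 4 + e + 2) + (1 + r)
            shift = solve-∀
  maximal-m : maximalFrom 0 W m ≡ true
  maximal-m = begin
      maximalFrom 0 W m                  ≡⟨ cong (maximalFrom 0 W) (shift P E) ⟩
      maximalFrom 0 W (P + (4 + (E + 2))) ≡⟨ maximalFrom-++ Y (4 + (E + 2)) climb-cs ⟩
      maximalFrom g Y (4 + (E + 2))       ≡⟨ maximalFrom-++ Y₂ (E + 2) climb-x ⟩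
      maximalFrom (suc g) Y₂ (E + 2)      ≡⟨ maximalFrom-++ Y₃ 2 climb-es ⟩
      maximalFrom (suc h) Y₃ 2            ≡⟨ maximalFrom-weight ⟦ fs ⟧ step-y ⟩
      (h ≡ᵇ h)                            ≡⟨ ≡ᵇ-refl h ⟩
      true                                ∎
    where shift : ∀ p e → p + 4 + e + 2 ≡ p + (4 + (e + 2))
          shift = solve-∀
  not-maximal-in-Y₂ : ∀ u → u < E + 2 → maximalFrom (suc g) Y₂ u ≡ false
  not-maximal-in-Y₂ u u<E+2 with u <? E
  ... | yes u<E = maximalFrom-avoiding es-not-maximal Y₃ u u<E
  ... | no u≮E with m≤n⇒∃[o]m+o≡n (≮⇒≥ u≮E)
  ...   | v , refl = trans (maximalFrom-++ Y₃ v climb-es) (star-or-U v (+-cancelˡ-< E v 2 u<E+2))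
    where
    star-or-U : ∀ v → v < 2 → maximalFrom (suc h) Y₃ v ≡ false
    star-or-U zero          _ = refl
    star-or-U (suc zero)    _ = refl
    star-or-U (suc (suc v)) (s≤s (s≤s ()))
  none-before : ∀ i → start ≤ i → i < m → maximalFrom 0 W i ≡ false
  none-before i start≤i i<m with m≤n⇒∃[o]m+o≡n start≤i
  ... | zero , refl = trans (cong (maximalFrom 0 W) (shift P)) (maximalFrom-++ Y 3 climb-cs)
    where shift : ∀ p → suc (p + 2) + 0 ≡ p + 3
          shift = solve-∀
  ... | suc u , refl =
    trans (cong (maximalFrom 0 W) (shift P u))
      (trans (maximalFrom-++ Y (4 + u) climb-cs)
        (trans (maximalFrom-++ Y₂ u climb-x)
          (not-maximal-in-Y₂ u (+-cancelˡ-< (P + 4) u (E + 2) (subst₂ _<_ (shift' P u) (regroup P E) i<m)))))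
    where shift : ∀ p u → suc (p + 2) + suc u ≡ p + (4 + u)
          shift = solve-∀
          shift' : ∀ p u → suc (p + 2) + suc u ≡ p + 4 + u
          shift' = solve-∀
          regroup : ∀ p e → p + 4 + e + 2 ≡ p + 4 + (e + 2)
          regroup = solve-∀

record LastEligible (g : ℕ) (bs : List Block) (g' : ℕ) : Set where
  constructor lastEligibleAt
  field
    es : List Block
    h : ℕ
    b : Bool
    h' : ℕ
    fs : List Block
    split : bs ≡ es ++ block true h b ∷ fs
    valid-es : Valid g es h
    step-x : Step h (block true h b) h'
    fs-not-eligible : Walk eligibleBlock h' fs g'

eligibleBlock-true : ∀ {g x} → eligibleBlock g x ≡ true → ∃[ b ] x ≡ block true g b
eligibleBlock-true {g} {block true n b} e with ≡ᵇ-true⇒≡ {n} {g} e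
... | refl = b , refl

lastEligible : ∀ {g bs g'} → Valid g bs g' → Walk eligibleBlock g bs g' ⊎ LastEligible g bs g'
lastEligible [] = inj₁ []
lastEligible {g} (cons {x = x} s _ p) with lastEligible p
... | inj₂ (lastEligibleAt es h b h' fs refl ves sx nfs) = inj₂ (lastEligibleAt (x ∷ es) h b h' fs refl (cons s refl ves) sx nfs)
... | inj₁ np with eligibleBlock g x in e
...   | false = inj₁ (cons s e np)
...   | true with eligibleBlock-true {g} {x} e
...     | b , refl = inj₂ (lastEligibleAt [] g b _ _ refl [] s np)

-- at level 0 the first block is D 0 _, which is eligible
first-block-eligible : ∀ {bs g' k} → Walk eligibleBlock 0 bs g' → length bs ≡ suc k → ⊥
first-block-eligible [] ()
first-block-eligible (cons (DD (s≤s z≤n)) () _) _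
first-block-eligible (cons (DU (s≤s z≤n)) () _) _

record FirstMaximal (f : ℕ → Block → Bool) (g : ℕ) (bs : List Block) (g' : ℕ) : Set where
  constructor firstMaximalAt
  field
    es : List Block
    y : Block
    hy : ℕ
    hy' : ℕ
    fs : List Block
    split : bs ≡ es ++ y ∷ fs
    es-not-maximal : Walk maximalBlock g es hy
    step-y : Step hy y hy'
    maximal-y : maximalBlock hy y ≡ true
    f-y : f hy y ≡ false
    walk-fs : Walk f hy' fs g'

firstMaximal : ∀ {f g bs g'} → Walk f g bs g' → Walk maximalBlock g bs g' ⊎ FirstMaximal f g bs g'
firstMaximal [] = inj₁ []
firstMaximal {g = g} (cons {x = x} s fx p) with maximalBlock g x in e
... | true = inj₂ (firstMaximalAt [] x g _ _ refl [] s e fx p)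
... | false with firstMaximal p
...   | inj₁ np = inj₁ (cons s e np)
...   | inj₂ (firstMaximalAt es y hy hy' fs refl nes sy my fy pfs) =
        inj₂ (firstMaximalAt (x ∷ es) y hy hy' fs refl (cons s e nes) sy my fy pfs)

-- the last block reaching level 0 is D 0 U or U 0 U, which is maximal
no-maximal-last-step : ∀ {g x bs} → Walk maximalBlock g (x ∷ bs) 0 → ⊥
no-maximal-last-step (cons _ _ (cons s e p)) = no-maximal-last-step (cons s e p)
no-maximal-last-step (cons (DU (s≤s z≤n)) () [])
no-maximal-last-step (cons (UU (s≤s z≤n)) () [])

no-maximal-walk-down : ∀ {h bs} → Walk maximalBlock (suc h) bs 0 → ⊥
no-maximal-walk-down {bs = x ∷ bs} p = no-maximal-last-step p

non-maximal⇒non-eligibleBlock : ∀ h x → maximalBlock h x ≡ false → eligibleBlock h x ≡ false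
non-maximal⇒non-eligibleBlock h (block true  n b) e = e
non-maximal⇒non-eligibleBlock h (block false n b) e = refl

lift : ∀ {g es g'} → Valid g es g' → Walk maximalBlock (suc g) es (suc g')
lift [] = []
lift (cons (DD n<) _ p) = cons (DD (m<n⇒m<1+n n<)) (<⇒≡ᵇ-false n<) (lift p)
lift (cons (DU n<) _ p) = cons (DU (m<n⇒m<1+n n<)) (<⇒≡ᵇ-false n<) (lift p)
lift (cons (UD n<) _ p) = cons (UD (m<n⇒m<1+n n<)) (<⇒≡ᵇ-false n<) (lift p)
lift (cons (UU n<) _ p) = cons (UU (m<n⇒m<1+n n<)) (<⇒≡ᵇ-false n<) (lift p)

lower : ∀ {g es g'} → Walk maximalBlock (suc g) es g' → ∃[ g'' ] (g' ≡ suc g'' × Valid g es g'')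
lower [] = _ , refl , []
lower (cons (DD n<) e p) with lower p
... | _ , refl , q = _ , refl , cons (DD (<-suc-≢ᵇ⇒< n< e)) refl q
lower (cons (DU n<) e p) with lower p
... | _ , refl , q = _ , refl , cons (DU (<-suc-≢ᵇ⇒< n< e)) refl q
lower {zero} (cons (UD n<) e p) with <-suc-≢ᵇ⇒< n< e
... | ()
lower {suc g} (cons (UD n<) e p) with lower p
... | _ , refl , q = _ , refl , cons (UD (<-suc-≢ᵇ⇒< n< e)) refl q
lower {zero} (cons (UU n<) e p) with <-suc-≢ᵇ⇒< n< e
... | ()
lower {suc g} (cons (UU n<) e p) with lower p
... | _ , refl , q = _ , refl , cons (UU (<-suc-≢ᵇ⇒< n< e)) refl q

flip-first : ∀ {h b h'} → Step h (block true h b) h' → Step (suc h) (block false h b) h'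
flip-first (DD _) = UD ≤-refl
flip-first (DU _) = UU ≤-refl

unflip-first : ∀ {h b h'} → Step (suc h) (block false h b) h' → Step h (block true h b) h'
unflip-first (UD _) = DD ≤-refl
unflip-first (UU _) = DU ≤-refl

split-at : ∀ {A : Set} (xs : List A) j → j ≤ length xs → ∃[ ys ] ∃[ zs ] (xs ≡ ys ++ zs × length ys ≡ j)
split-at xs       zero    _       = [] , xs , refl , refl
split-at (x ∷ xs) (suc j) (s≤s j≤) with split-at xs j j≤
... | ys , zs , refl , refl = x ∷ ys , zs , refl , refl

length-++-exchange : ∀ {A : Set} (xs : List A) y z ys → length (xs ++ y ∷ ys) ≡ length (xs ++ z ∷ ys)
length-++-exchange xs y z ys = trans (length-++-sucʳ xs y ys) (sym (length-++-sucʳ xs z ys))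

record Insertion (vs : List Block) (j : ℕ) (ws : List Block) : Set where
  field
    valid-vs  : Valid 0 vs 0
    valid-ws  : Valid 0 ws 0
    j≤length  : j ≤ length vs
    length-ws : length ws ≡ suc (length vs)
    inserts   : insert ⟦ vs ⟧ j ≡ just ⟦ ws ⟧
    inverts   : invert ⟦ ws ⟧ ≡ just (⟦ vs ⟧ , j)

column-insertion : ∀ {cs g ds} → Valid 0 cs g → Walk eligibleBlock g ds 0 →
                   Insertion (cs ++ ds) (length cs) (cs ++ block true g false ∷ ds)
column-insertion {cs} {g} {ds} vcs nds = record
  { valid-vs  = Walk-++ vcs (toValid nds)
  ; valid-ws  = Walk-++ vcs (cons (DU ≤-refl) refl (toValid nds))
  ; j≤length  = length-++-≤ˡ cs
  ; length-ws = length-++-sucʳ cs (block true g false) ds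
  ; inserts   = trans (inserts-column (lastEligible vcs)) (cong just (columnAddition-⟦⟧ ds vcs))
  ; inverts   = trans (invert-followed-by-U _ (width cs + 2) (special-at vcs (DU ≤-refl) nds)
                                            (at-after-weight cs true g false ds))
                      (cong just (removeFactor-⟦⟧ cs true g false ds))
  }
  where
  inserts-column : Walk eligibleBlock 0 cs g ⊎ LastEligible 0 cs g →
                   insert ⟦ cs ++ ds ⟧ (length cs) ≡ just (columnAddition ⟦ cs ++ ds ⟧ (width cs))
  inserts-column (inj₁ ncs) =
    insert-without-special _ _ _ (starPos-⟦⟧ cs ds) (special-none (Walk-++ ncs nds))
  inserts-column (inj₂ (lastEligibleAt es h b h' fs refl ves sx nfs)) =
    insert-right-of-special _ _ _ _ (starPos-⟦⟧ cs ds) special-x x-before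
    where
    x = block true h b
    special-x : special ⟦ (es ++ x ∷ fs) ++ ds ⟧ ≡ just (width es + 2)
    special-x = trans (cong (λ z → special ⟦ z ⟧) (++-assoc es (x ∷ fs) ds)) (special-at ves sx (Walk-++ nfs nds))
    x-before : width es + 2 ≤ width (es ++ x ∷ fs)
    x-before = subst (width es + 2 ≤_) (sym (width-++ es (x ∷ fs))) (+-monoʳ-≤ (width es) (s≤s (s≤s z≤n)))

ribbon-insertion : ∀ {cs g es h b h' fs} → Valid 0 cs g → Valid g es h → Step h (block true h b) h' →
                   Walk eligibleBlock h' fs 0 →
                   Insertion (cs ++ es ++ block true h b ∷ fs) (length cs)
                             (cs ++ block true g true ∷ es ++ block false h b ∷ fs)
ribbon-insertion {cs} {g} {es} {h} {b} {h'} {fs} vcs ves sx nfs = record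
  { valid-vs  = Walk-++ vcs (Walk-++ ves (cons sx refl (toValid nfs)))
  ; valid-ws  = Walk-++ vcs (cons (DD ≤-refl) refl (toValid tail-not-eligible))
  ; j≤length  = length-++-≤ˡ cs
  ; length-ws = trans (length-++-sucʳ cs _ (es ++ y ∷ fs))
                      (cong suc (subst₂ (λ u v → length u ≡ length v) (++-assoc cs es (y ∷ fs)) (++-assoc cs es (x ∷ fs))
                                        (length-++-exchange (cs ++ es) y x fs)))
  ; inserts   = begin
      insert ⟦ cs ++ es ++ x ∷ fs ⟧ (length cs)
    ≡⟨ insert-left-of-special ⟦ cs ++ es ++ x ∷ fs ⟧ _ _ _ (starPos-⟦⟧ cs _) special-x x-after ⟩
      just (swap (columnAddition ⟦ cs ++ es ++ x ∷ fs ⟧ (width cs)) (width cs + 3) (width (cs ++ es) + 2 + 3))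
    ≡⟨ cong (λ v → just (swap v (width cs + 3) (width (cs ++ es) + 2 + 3))) (columnAddition-⟦⟧ (es ++ x ∷ fs) vcs) ⟩
      just (swap ⟦ cs ++ block true g false ∷ es ++ x ∷ fs ⟧ (width cs + 3) (width (cs ++ es) + 2 + 3))
    ≡⟨ cong just (swap-⟦⟧ cs g false es true h b fs refl ribbon-position) ⟩
      just ⟦ cs ++ block true g true ∷ es ++ y ∷ fs ⟧ ∎
  ; inverts   = begin
      invert ⟦ cs ++ block true g true ∷ es ++ y ∷ fs ⟧
    ≡⟨ invert-followed-by-D ⟦ cs ++ block true g true ∷ es ++ y ∷ fs ⟧ (width cs + 2) (width cs + 4 + width es + 2)
                            (special-at vcs (DD ≤-refl) tail-not-eligible) (at-after-weight cs true g true _)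
                            (leftmostMaximal-⟦⟧ b fs vcs (lift ves) (flip-first sx)) ⟩
      just (removeFactor (swap ⟦ cs ++ block true g true ∷ es ++ y ∷ fs ⟧ (suc (width cs + 2))
                                                                      (width cs + 4 + width es + 2 ∸ 1)) (width cs + 2))
    ≡⟨ cong (λ v → just (removeFactor v (width cs + 2)))
            (swap-⟦⟧ cs g true es false h b fs (sym (+-suc (width cs) 2)) (cong (_∸ 1) (unribbon-position (width cs) (width es)))) ⟩
      just (removeFactor ⟦ cs ++ block true g false ∷ es ++ x ∷ fs ⟧ (width cs + 2))
    ≡⟨ cong just (removeFactor-⟦⟧ cs true g false (es ++ x ∷ fs)) ⟩
      just (⟦ cs ++ es ++ x ∷ fs ⟧ , length cs) ∎
  }
  where
  open ≡-Reasoning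
  x = block true h b
  y = block false h b
  tail-not-eligible : Walk eligibleBlock (suc g) (es ++ y ∷ fs) 0
  tail-not-eligible = Walk-++ (Walk-map non-maximal⇒non-eligibleBlock (lift ves)) (cons (flip-first sx) refl nfs)
  special-x : special ⟦ cs ++ es ++ x ∷ fs ⟧ ≡ just (width (cs ++ es) + 2)
  special-x = trans (cong (λ z → special ⟦ z ⟧) (sym (++-assoc cs es (x ∷ fs)))) (special-at (Walk-++ vcs ves) sx nfs)
  x-after : width cs < width (cs ++ es) + 2
  x-after rewrite width-++ cs es = ≤-<-trans (m≤m+n (width cs) (width es)) (m<m+n (width cs + width es) (s≤s z≤n))
  ribbon-position : width (cs ++ es) + 2 + 3 ≡ suc (width cs + 3 + (width es + 1))
  ribbon-position rewrite width-++ cs es = shift (width cs) (width es)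
    where shift : ∀ p e → p + e + 2 + 3 ≡ suc (p + 3 + (e + 1))
          shift = solve-∀
  unribbon-position : ∀ p e → p + 4 + e + 2 ≡ suc (suc (p + 3 + (e + 1)))
  unribbon-position = solve-∀

insertion-of : ∀ {bs} → Valid 0 bs 0 → ∀ j → j ≤ length bs → ∃[ ws ] Insertion bs j ws
insertion-of {bs} vbs j j≤ with split-at bs j j≤
... | cs , ds , refl , refl with Walk-split cs vbs
...   | g , vcs , vds with lastEligible vds
...     | inj₁ nds = _ , column-insertion vcs nds
...     | inj₂ (lastEligibleAt es h b h' fs refl ves sx nfs) = _ , ribbon-insertion vcs ves sx nfs

insertion-into : ∀ {ws k} → Valid 0 ws 0 → length ws ≡ suc k → ∃[ vs ] ∃[ j ] Insertion vs j ws
insertion-into vws length-ws with lastEligible vws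
... | inj₁ nws = ⊥-elim (first-block-eligible nws length-ws)
... | inj₂ (lastEligibleAt es h false h' fs refl ves (DU _) nfs) = _ , _ , column-insertion ves nfs
... | inj₂ (lastEligibleAt es h true h' fs refl ves (DD _) nfs) with firstMaximal nfs
...   | inj₁ nmfs = ⊥-elim (no-maximal-walk-down nmfs)
-- after the special weight, a maximal weight preceded by D would be eligible
...   | inj₂ (firstMaximalAt _ (block true m b) _ _ _ _ _ _ my ey _) with trans (sym my) ey
...     | ()
insertion-into vws length-ws | inj₂ (lastEligibleAt es h true h' fs refl ves (DD _) nfs)
  | inj₂ (firstMaximalAt es' (block false m b) hy hy' fs' refl nes sy my _ nfs') with lower nes
... | hm , refl , ves' with ≡ᵇ-true⇒≡ {m} {hm} my
...   | refl = _ , _ , ribbon-insertion ves ves' (unflip-first sy) nfs'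

insert-then-invert : ∀ (w : Word) (k j : ℕ) → IsWDW w → size w ≡ k → j ≤ k →
  ∃[ w' ] (insert w j ≡ just w' × IsWDW w' × size w' ≡ suc k × invert w' ≡ just (w , j))
insert-then-invert w k j wdw refl j≤k with wdw⇒valid wdw
... | bs , refl , vbs with insertion-of vbs j (subst (j ≤_) (size-⟦⟧ bs) j≤k)
...   | ws , ins = ⟦ ws ⟧ , inserts , valid⇒wdw valid-ws , size-ws , inverts
  where
  open Insertion ins
  size-ws : size ⟦ ws ⟧ ≡ suc (size ⟦ bs ⟧)
  size-ws = trans (size-⟦⟧ ws) (trans length-ws (cong suc (sym (size-⟦⟧ bs))))

invert-then-insert : ∀ (w : Word) (k : ℕ) → IsWDW w → size w ≡ suc k →
  ∃[ w' ] ∃[ j ] (invert w ≡ just (w' , j) × IsWDW w' × size w' ≡ k × j ≤ k × insert w' j ≡ just w)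
invert-then-insert w k wdw size-w with wdw⇒valid wdw
... | ws , refl , vws with insertion-into vws (trans (sym (size-⟦⟧ ws)) size-w)
...   | vs , j , ins =
  ⟦ vs ⟧ , j , inverts , valid⇒wdw valid-vs , trans (size-⟦⟧ vs) length-vs , subst (j ≤_) length-vs j≤length , inserts
  where
  open Insertion ins
  length-vs : length vs ≡ k
  length-vs = suc-injective (trans (sym length-ws) (trans (sym (size-⟦⟧ ws)) size-w))

proposition5 :
    (∀ (w : Word) (k j : ℕ) → IsWDW w → size w ≡ k → j ≤ k →
      ∃[ w' ] (insert w j ≡ just w' × IsWDW w' × size w' ≡ suc k
               × invert w' ≡ just (w , j)))
    ×
    (∀ (w : Word) (k : ℕ) → IsWDW w → size w ≡ suc k →
      ∃[ w' ] ∃[ j ] (invert w ≡ just (w' , j) × IsWDW w' × size w' ≡ k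
                      × j ≤ k × insert w' j ≡ just w))
proposition5 = insert-then-invert , invert-then-insert
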